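{- Let $N$ be a network and $u,v$ nodes of $N$. Then $u\sim v$ if and only if there is an undirected path between $u$ and $v$ (a path using only undirected edges of $N$).
   Context: A semidirected graph is $N=(V,E)$ with $E=E_U\sqcup E_D$, $E_U$ undirected edges $uv$, $E_D$ directed edges $(u,v)$; parallel directed edges allowed, no self-loops. $\deg_i(v,N)$ is the number of directed edges with child $v$. $N'$ is compatible with $N$ if obtained by directing some undirected edges. A semidirected cycle is a semidirected graph whose undirected edges can be directed to make it a directed cycle; acyclic (SDAG) means containing no semidirected cycle; DAG = acyclic directed graph. Tree node: $\deg_i\le1$; hybrid node otherwise. Hybrid edge: directed edge whose child is hybrid; $E_H(N)$ the set of them. SDAG $N'$ is phylogenetically compatible with SDAG $N$ if $N'$ is compatible with $N$ and $E_H(N')=E_H(N)$; a rooted partner of $N$ is a DAG phylogenetically compatible with $N$; a network is an SDAG admitting a rooted partner. A semidirected path from $u_0$ to $u_n$ is a sequence $u_0u_1\dots u_n$ such that for each $i$, $u_{i-1}u_i$ or $(u_{i-1},u_i)$ is an edge of $N$. Write $v\lesssim u$ if there is a semidirected path from $u$ to $v$, and $u\sim v$ if $u\lesssim v$ and $v\lesssim u$. -}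

module Defs where

open import Data.Nat using (ℕ; zero; suc; _+_; _≤_)
open import Data.Fin using (Fin; zero; suc; inject₁; fromℕ)
open import Data.Bool using (Bool; true; false; if_then_else_)
open import Data.Product using (Σ; _×_; _,_; proj₁; proj₂; swap)
open import Data.Sum using (_⊎_)
open import Data.Empty using (⊥)
open import Relation.Nullary using (¬_; does)
open import Relation.Binary.PropositionalEquality using (_≡_; _≢_)
open import Function.Definitions using (Injective)
import Data.Fin as F

-- Edges are indexed by Fin m, m fixed in the type (so parallel edges are possible and edges have identity).
-- For a directed edge e, ends e = (tail , head) = (parent , child).
-- For an undirected edge e, ends e = (a , b) denotes the unordered pair {a , b}.
record SDG (n m : ℕ) : Set where
  field
    ends     : Fin m → Fin n × Fin n
    directed : Fin m → Bool
open SDG public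

SamePair : ∀ {n} → Fin n × Fin n → Fin n × Fin n → Set
SamePair p q = p ≡ q ⊎ p ≡ swap q

record WellFormed {n m : ℕ} (N : SDG n m) : Set where
  field
    noLoops     : ∀ e → proj₁ (ends N e) ≢ proj₂ (ends N e)
    undirSimple : ∀ e e' → e ≢ e' → directed N e ≡ false →
                  ¬ SamePair (ends N e) (ends N e')

Traverses : ∀ {n m} (N : SDG n m) → Fin m → Fin n → Fin n → Set
Traverses N e a b =
  (directed N e ≡ true × ends N e ≡ (a , b)) ⊎
  (directed N e ≡ false × SamePair (ends N e) (a , b))

-- A semidirected cycle (as a subgraph): k+1 distinct nodes v₀ … v_k and k+1 distinct
-- edges, edge i joining v_i to v_{i+1} (indices mod k+1) in the traversable direction.
record SemidirectedCycle {n m : ℕ} (N : SDG n m) : Set where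
  field
    k      : ℕ
    vs     : Fin (suc k) → Fin n
    es     : Fin (suc k) → Fin m
    vsInj  : Injective _≡_ _≡_ vs
    esInj  : Injective _≡_ _≡_ es
    steps  : ∀ (i : Fin k) → Traverses N (es (inject₁ i)) (vs (inject₁ i)) (vs (suc i))
    close  : Traverses N (es (fromℕ k)) (vs (fromℕ k)) (vs zero)

Acyclic : ∀ {n m} → SDG n m → Set
Acyclic N = ¬ SemidirectedCycle N

AllDirected : ∀ {n m} → SDG n m → Set
AllDirected N = ∀ e → directed N e ≡ true

IsDAG : ∀ {n m} → SDG n m → Set
IsDAG N = AllDirected N × Acyclic N

countF : ∀ {m} → (Fin m → Bool) → ℕ
countF {zero}  p = 0
countF {suc m} p = (if p zero then 1 else 0) + countF (λ i → p (suc i))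

indeg : ∀ {n m} (N : SDG n m) → Fin n → ℕ
indeg N v = countF (λ e → directed N e Data.Bool.∧ does (proj₂ (ends N e) F.≟ v))
  where import Data.Bool

IsHybridNode : ∀ {n m} → SDG n m → Fin n → Set
IsHybridNode N v = 2 ≤ indeg N v

IsHybridEdge : ∀ {n m} (N : SDG n m) → Fin m → Set
IsHybridEdge N e = directed N e ≡ true × IsHybridNode N (proj₂ (ends N e))

-- N' is compatible with N: N' is obtained from N by directing some undirected edges
-- (edges are identified by their index).
Compatible : ∀ {n m} → SDG n m → SDG n m → Set
Compatible N' N = ∀ (e : Fin _) →
      (directed N e ≡ true × directed N' e ≡ true × ends N' e ≡ ends N e) ⊎
      (directed N e ≡ false × directed N' e ≡ false × ends N' e ≡ ends N e) ⊎
      (directed N e ≡ false × directed N' e ≡ true × SamePair (ends N' e) (ends N e))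

record PhyloCompatible {n m : ℕ} (N' N : SDG n m) : Set where
  field
    compat   : Compatible N' N
    sameHyb→ : ∀ (e : Fin m) → IsHybridEdge N e → IsHybridEdge N' e
    sameHyb← : ∀ (e : Fin m) → IsHybridEdge N' e → IsHybridEdge N e

RootedPartner : ∀ {n m} → SDG n m → SDG n m → Set
RootedPartner N' N = IsDAG N' × PhyloCompatible N' N

IsNetwork : ∀ {n m} → SDG n m → Set
IsNetwork {n} {m} N = Acyclic N × Σ (SDG n m) (λ N' → RootedPartner N' N)

data SDPath {n m : ℕ} (N : SDG n m) : Fin n → Fin n → Set where
  here : ∀ {u} → SDPath N u u
  step : ∀ {u w v} (e : Fin m) → Traverses N e u w → SDPath N w v → SDPath N u v

_≲⟨_⟩_ : ∀ {n m} → Fin n → SDG n m → Fin n → Set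
v ≲⟨ N ⟩ u = SDPath N u v

_∼⟨_⟩_ : ∀ {n m} → Fin n → SDG n m → Fin n → Set
u ∼⟨ N ⟩ v = (u ≲⟨ N ⟩ v) × (v ≲⟨ N ⟩ u)

data UPath {n m : ℕ} (N : SDG n m) : Fin n → Fin n → Set where
  here : ∀ {u} → UPath N u u
  step : ∀ {u w v} (e : Fin m) → directed N e ≡ false →
         SamePair (ends N e) (u , w) → UPath N w v → UPath N u v

-- An undirected path is a semidirected path in both directions. Conversely,
-- if u ⇝ v is semidirected and not purely undirected, it passes some directed edge (a , b);
-- continuing b ⇝ v ⇝ u ⇝ a and erasing loops gives a simple path from b back to a, which
-- the edge (a , b) closes into a semidirected cycle.
module Submission where

open import Defs
open import Data.Nat using (ℕ; zero; suc)
open import Data.Fin using (Fin; zero; suc; inject₁; fromℕ; _≟_)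
open import Data.Fin.Properties using (0≢1+n)
open import Data.Vec.Functional using (Vector; _∷_)
open import Data.Bool using (true)
open import Data.Product using (_×_; _,_; proj₁; proj₂)
open import Data.Sum using (_⊎_; inj₁; inj₂)
open import Data.Empty using (⊥-elim)
open import Function using (_∘_)
open import Function.Bundles using (_⇔_; mk⇔)
open import Function.Definitions using (Injective)
open import Relation.Nullary using (¬_; yes; no)
open import Relation.Binary.PropositionalEquality

module _ {n m : ℕ} (N : SDG n m) where

  SamePair-swap : {p : Fin n × Fin n} {u w : Fin n} → SamePair p (u , w) → SamePair p (w , u)
  SamePair-swap (inj₁ eq) = inj₂ eq
  SamePair-swap (inj₂ eq) = inj₁ eq

  Traverses-source : ∀ {e x y x′ y′} → Traverses N e x y → Traverses N e x′ y′ → x ≡ x′ ⊎ x ≡ y′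
  Traverses-source (inj₁ (_ , p)) (inj₁ (_ , q)) = inj₁ (cong proj₁ (trans (sym p) q))
  Traverses-source (inj₁ (d , _)) (inj₂ (d′ , _)) with () ← trans (sym d) d′
  Traverses-source (inj₂ (d , _)) (inj₁ (d′ , _)) with () ← trans (sym d) d′
  Traverses-source (inj₂ (_ , inj₁ p)) (inj₂ (_ , inj₁ q)) = inj₁ (cong proj₁ (trans (sym p) q))
  Traverses-source (inj₂ (_ , inj₁ p)) (inj₂ (_ , inj₂ q)) = inj₂ (cong proj₁ (trans (sym p) q))
  Traverses-source (inj₂ (_ , inj₂ p)) (inj₂ (_ , inj₁ q)) = inj₂ (cong proj₂ (trans (sym p) q))
  Traverses-source (inj₂ (_ , inj₂ p)) (inj₂ (_ , inj₂ q)) = inj₁ (cong proj₂ (trans (sym p) q))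

  _++_ : ∀ {x y z} → SDPath N x y → SDPath N y z → SDPath N x z
  here       ++ q = q
  step e t p ++ q = step e t (p ++ q)

  UPath⇒SDPath : ∀ {u v} → UPath N u v → SDPath N u v
  UPath⇒SDPath here            = here
  UPath⇒SDPath (step e d sp p) = step e (inj₂ (d , sp)) (UPath⇒SDPath p)

  UPath-reverse : ∀ {u v} → UPath N u v → UPath N v u
  UPath-reverse p = reverseOnto p here
    where
      reverseOnto : ∀ {u v w} → UPath N u v → UPath N u w → UPath N v w
      reverseOnto here            acc = acc
      reverseOnto (step e d sp p) acc = reverseOnto p (step e d (SamePair-swap sp) acc)

  record ViaDirectedEdge (u v : Fin n) : Set where
    field
      {tail head} : Fin n
      edge        : Fin m
      isDirected  : directed N edge ≡ true
      edgeEnds    : ends N edge ≡ (tail , head)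
      before      : SDPath N u tail
      after       : SDPath N head v

  UPath-or-ViaDirectedEdge : ∀ {u v} → SDPath N u v → UPath N u v ⊎ ViaDirectedEdge u v
  UPath-or-ViaDirectedEdge here = inj₁ here
  UPath-or-ViaDirectedEdge (step e (inj₁ (d , eq)) p) =
    inj₂ (record { edge = e ; isDirected = d ; edgeEnds = eq ; before = here ; after = p })
  UPath-or-ViaDirectedEdge (step e (inj₂ (d , sp)) p) with UPath-or-ViaDirectedEdge p
  ... | inj₁ q   = inj₁ (step e d sp q)
  ... | inj₂ via = inj₂ (record
    { edge = edge ; isDirected = isDirected ; edgeEnds = edgeEnds
    ; before = step e (inj₂ (d , sp)) before ; after = after })
    where open ViaDirectedEdge via

  mutual
    data SimplePath : Fin n → Fin n → Set where
      here : ∀ {a} → SimplePath a a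
      step : ∀ {x w a} (e : Fin m) → Traverses N e x w →
             (q : SimplePath w a) → x ∉ q → SimplePath x a

    _∉_ : ∀ {x a} → Fin n → SimplePath x a → Set
    y ∉ here {a}             = y ≢ a
    y ∉ step {x = x} _ _ q _ = y ≢ x × y ∉ q

  length : ∀ {x a} → SimplePath x a → ℕ
  length here           = zero
  length (step _ _ q _) = suc (length q)

  nodes : ∀ {x a} (q : SimplePath x a) → Vector (Fin n) (suc (length q))
  nodes (here {a})             = λ _ → a
  nodes (step {x = x} _ _ q _) = x ∷ nodes q

  edgesThen : ∀ {x a} (q : SimplePath x a) → Fin m → Vector (Fin m) (suc (length q))
  edgesThen here           e = λ _ → e
  edgesThen (step f _ q _) e = f ∷ edgesThen q e

  nodes-first : ∀ {x a} (q : SimplePath x a) → nodes q zero ≡ x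
  nodes-first here           = refl
  nodes-first (step _ _ _ _) = refl

  nodes-last : ∀ {x a} (q : SimplePath x a) → nodes q (fromℕ (length q)) ≡ a
  nodes-last here           = refl
  nodes-last (step _ _ q _) = nodes-last q

  edgesThen-last : ∀ {x a} (q : SimplePath x a) e → edgesThen q e (fromℕ (length q)) ≡ e
  edgesThen-last here           e = refl
  edgesThen-last (step _ _ q _) e = edgesThen-last q e

  edgesThen-traverses : ∀ {x a} (q : SimplePath x a) e (i : Fin (length q)) →
    Traverses N (edgesThen q e (inject₁ i)) (nodes q (inject₁ i)) (nodes q (suc i))
  edgesThen-traverses (step {x = x} f t q _) e zero =
    subst (Traverses N f x) (sym (nodes-first q)) t
  edgesThen-traverses (step _ _ q _) e (suc i) = edgesThen-traverses q e i

  ∉⇒nodes≢ : ∀ {x a y} (q : SimplePath x a) → y ∉ q → ∀ i → nodes q i ≢ y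
  ∉⇒nodes≢ here           y∉q i       = y∉q ∘ sym
  ∉⇒nodes≢ (step _ _ q _) y∉q zero    = proj₁ y∉q ∘ sym
  ∉⇒nodes≢ (step _ _ q _) y∉q (suc i) = ∉⇒nodes≢ q (proj₂ y∉q) i

  nodes-injective : ∀ {x a} (q : SimplePath x a) → Injective _≡_ _≡_ (nodes q)
  nodes-injective here             {zero}  {zero}  _  = refl
  nodes-injective (step _ _ q x∉q) {zero}  {zero}  _  = refl
  nodes-injective (step _ _ q x∉q) {zero}  {suc j} eq = ⊥-elim (∉⇒nodes≢ q x∉q j (sym eq))
  nodes-injective (step _ _ q x∉q) {suc i} {zero}  eq = ⊥-elim (∉⇒nodes≢ q x∉q i eq)
  nodes-injective (step _ _ q x∉q) {suc i} {suc j} eq = cong suc (nodes-injective q eq)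

  -- An edge of q with x as an end would force x onto q.
  edgesThen-avoids : ∀ {w a x y f e} (q : SimplePath w a) → x ∉ q → Traverses N f x y → f ≢ e →
                     ∀ j → edgesThen q e j ≢ f
  edgesThen-avoids here _ _ f≢e _ refl = f≢e refl
  edgesThen-avoids (step {x = w} {w = w′} _ t q _) x∉ f-xy f≢e zero refl
    with Traverses-source f-xy t
  ... | inj₁ x≡w  = proj₁ x∉ x≡w
  ... | inj₂ x≡w′ = ∉⇒nodes≢ q (proj₂ x∉) zero (trans (nodes-first q) (sym x≡w′))
  edgesThen-avoids (step _ _ q _) x∉ f-xy f≢e (suc j) =
    edgesThen-avoids q (proj₂ x∉) f-xy f≢e j

  edgesThen-injective : ∀ {x a} (q : SimplePath x a) e →
                        (∀ i → edgesThen q e (inject₁ i) ≢ e) → Injective _≡_ _≡_ (edgesThen q e)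
  edgesThen-injective here             e _   {zero}  {zero}  _  = refl
  edgesThen-injective (step _ _ _ _)   e _   {zero}  {zero}  _  = refl
  edgesThen-injective (step _ t q x∉q) e new {zero}  {suc j} eq =
    ⊥-elim (edgesThen-avoids q x∉q t (new zero) j (sym eq))
  edgesThen-injective (step _ t q x∉q) e new {suc i} {zero}  eq =
    ⊥-elim (edgesThen-avoids q x∉q t (new zero) i eq)
  edgesThen-injective (step _ _ q _)   e new {suc i} {suc j} eq =
    cong suc (edgesThen-injective q e (new ∘ suc) eq)

  dropUntil : ∀ {x a} (y : Fin n) (q : SimplePath x a) → SimplePath y a ⊎ y ∉ q
  dropUntil y (here {a}) with y ≟ a
  ... | yes refl = inj₁ here
  ... | no y≢a   = inj₂ y≢a
  dropUntil y (step {x = x} e t q x∉q) with y ≟ x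
  ... | yes refl = inj₁ (step e t q x∉q)
  ... | no y≢x with dropUntil y q
  ...   | inj₁ q′  = inj₁ q′
  ...   | inj₂ y∉q = inj₂ (y≢x , y∉q)

  loopErase : ∀ {x a} → SDPath N x a → SimplePath x a
  loopErase here = here
  loopErase (step {u = x} e t p) with dropUntil x (loopErase p)
  ... | inj₁ q   = q
  ... | inj₂ x∉q = step e t (loopErase p) x∉q

  module _ {a b e} (q : SimplePath b a) (e-dir : directed N e ≡ true) (e-ends : ends N e ≡ (a , b)) where

    -- The head of e is the first node of q, which no edge of q enters.
    closingEdge-new : ∀ i → edgesThen q e (inject₁ i) ≢ e
    closingEdge-new i eq with subst (λ f → Traverses N f _ _) eq (edgesThen-traverses q e i)
    ... | inj₂ (e-undir , _) with () ← trans (sym e-dir) e-undir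
    ... | inj₁ (_ , e-ends′) =
      0≢1+n (nodes-injective q (trans (nodes-first q) (cong proj₂ (trans (sym e-ends) e-ends′))))

    closingCycle : SemidirectedCycle N
    closingCycle = record
      { k     = length q
      ; vs    = nodes q
      ; es    = edgesThen q e
      ; vsInj = nodes-injective q
      ; esInj = edgesThen-injective q e closingEdge-new
      ; steps = edgesThen-traverses q e
      ; close = subst₂ (Traverses N _) (sym (nodes-last q)) (sym (nodes-first q))
                  (subst (λ f → Traverses N f a b) (sym (edgesThen-last q e)) (inj₁ (e-dir , e-ends)))
      }

  Acyclic⇒no-return-path : Acyclic N → ∀ {a b e} → directed N e ≡ true → ends N e ≡ (a , b) →
                           ¬ SDPath N b a
  Acyclic⇒no-return-path acyclic e-dir e-ends p = acyclic (closingCycle (loopErase p) e-dir e-ends)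

  Acyclic⇒∼⇒UPath : Acyclic N → ∀ {u v} → u ∼⟨ N ⟩ v → UPath N u v
  Acyclic⇒∼⇒UPath acyclic (v⇝u , u⇝v) with UPath-or-ViaDirectedEdge u⇝v
  ... | inj₁ p   = p
  ... | inj₂ via = ⊥-elim (Acyclic⇒no-return-path acyclic isDirected edgeEnds (after ++ (v⇝u ++ before)))
    where open ViaDirectedEdge via

  UPath⇒∼ : ∀ {u v} → UPath N u v → u ∼⟨ N ⟩ v
  UPath⇒∼ p = UPath⇒SDPath (UPath-reverse p) , UPath⇒SDPath p

proposition4 : (n m : ℕ) (N : SDG n m) → WellFormed N → IsNetwork N →
               (u v : Fin n) → (u ∼⟨ N ⟩ v) ⇔ UPath N u v
proposition4 n m N _ (acyclic , _) u v = mk⇔ (Acyclic⇒∼⇒UPath N acyclic) (UPath⇒∼ N)
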